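{- Let $p$ be a prime, let $A$ be a matrix over $GF(p)$ whose columns are labelled by a finite set $E$, let $M=M[A]$, let $a,b\in E$ be distinct, $\alpha\in GF(p)\setminus\{0\}$, and let $M_{a,b}$ be the splitting matroid. Let $r$ and $r'$ be the rank functions of $M$ and $M_{a,b}$. For every $S\subseteq E$: $r'(S)=r(S)$ if $S$ contains no $np$-circuit of $M$, and $r'(S)=r(S)+1$ if $S$ contains an $np$-circuit of $M$.
   Context: The splitting matroid $M_{a,b}$ is $M[A_{a,b}]$, where $A_{a,b}$ is $A$ with an appended row having entries $\alpha$ in columns $a,b$ and $0$ elsewhere. For a circuit $C$ of $M$, its columns satisfy $\sum_{u\in C}c_u u=0$ over $GF(p)$ with all $c_u\ne0$ (unique up to nonzero scalar). $C$ is an $np$-circuit if $|C\cap\{a,b\}|=1$, or $a,b\in C$ and $c_a+c_b\ne0$. -}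

module Defs where

open import Data.Nat using (ℕ; zero; suc; _+_; _*_; _≤_)
open import Relation.Binary.PropositionalEquality using (_≡_)
open import Data.Nat.Divisibility using (_∣_)
open import Data.Fin using (Fin; zero; suc; _≟_)
open import Data.Fin.Subset using (Subset; _∈_; _∉_; _⊆_; _⊂_; ∣_∣)
open import Data.Product using (Σ; ∃; ∃-syntax; _×_; _,_)
open import Data.Sum using (_⊎_)
open import Relation.Nullary using (¬_; yes; no)

-- Elements of GF(p) are represented by natural numbers; x is zero in GF(p)
-- iff p ∣ x.  All arithmetic is ordinary ℕ arithmetic read modulo p.

Matrix : ℕ → ℕ → Set
Matrix m n = Fin m → Fin n → ℕ

sumFin : (n : ℕ) → (Fin n → ℕ) → ℕ
sumFin zero    f = 0
sumFin (suc n) f = f zero + sumFin n (λ i → f (suc i))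

IsDependency : ∀ {m n} → ℕ → Matrix m n → (Fin n → ℕ) → Set
IsDependency {m} {n} p A c = ∀ (i : Fin m) → p ∣ sumFin n (λ u → c u * A i u)

SupportedOn : ∀ {n} → ℕ → (Fin n → ℕ) → Subset n → Set
SupportedOn p c T = ∀ u → ¬ (p ∣ c u) → u ∈ T

SupportExactly : ∀ {n} → ℕ → (Fin n → ℕ) → Subset n → Set
SupportExactly p c T = ∀ u → (u ∈ T → ¬ (p ∣ c u)) × (u ∉ T → p ∣ c u)

Dependent : ∀ {m n} → ℕ → Matrix m n → Subset n → Set
Dependent p A T = ∃[ c ] (SupportedOn p c T × IsDependency p A c × ∃[ u ] ¬ (p ∣ c u))

Independent : ∀ {m n} → ℕ → Matrix m n → Subset n → Set
Independent p A T = ¬ Dependent p A T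

IsRank : ∀ {m n} → ℕ → Matrix m n → Subset n → ℕ → Set
IsRank p A S k =
  (∃[ T ] (T ⊆ S × Independent p A T × ∣ T ∣ ≡ k))
  × (∀ T → T ⊆ S → Independent p A T → ∣ T ∣ ≤ k)

Circuit : ∀ {m n} → ℕ → Matrix m n → Subset n → Set
Circuit p A C = Dependent p A C × (∀ T → T ⊂ C → Independent p A T)

NpCircuit : ∀ {m n} → ℕ → Matrix m n → Fin n → Fin n → Subset n → Set
NpCircuit p A a b C =
  Circuit p A C ×
  ( (a ∈ C × b ∉ C)
  ⊎ (a ∉ C × b ∈ C)
  ⊎ (a ∈ C × b ∈ C ×
       ∃[ c ] (SupportExactly p c C × IsDependency p A c × ¬ (p ∣ (c a + c b)))) )

-- splitting matrix A_{a,b}: A with an extra row having α in columns a, b, 0 elsewhere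
-- (the extra row is placed as row 0; row order does not affect the matroid)
splitRow : ∀ {n} → Fin n → Fin n → ℕ → Fin n → ℕ
splitRow a b α u with u ≟ a | u ≟ b
... | yes _ | _     = α
... | no _  | yes _ = α
... | no _  | no _  = 0

splitMatrix : ∀ {m n} → Matrix m n → Fin n → Fin n → ℕ → Matrix (suc m) n
splitMatrix A a b α zero    u = splitRow a b α u
splitMatrix A a b α (suc i) u = A i u

-- A dependency c of the columns of A is a dependency of A_{a,b} iff α (c_a + c_b) = 0, i.e. iff
-- c_a + c_b = 0.  Say that the new row breaks c otherwise.  If some dependency supported in S is
-- broken, shrinking its support (cancelling against dependencies on smaller sets) yields a broken
-- circuit vector, i.e. an np-circuit in S; conversely an np-circuit carries a broken dependency.
-- With no broken dependency in S, M and M_{a,b} have the same independent subsets of S.  Otherwise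
-- the rank grows by exactly one: deleting one element from an M_{a,b}-independent set makes it
-- M-independent, and if the ranks were equal, an M-basis T₀ of S would span S in M_{a,b}, so
-- eliminating the coordinates outside T₀ from a broken dependency would leave a broken dependency
-- on the independent set T₀, which is impossible.

module Submission where

open import Defs
open import Data.Bool using (not)
open import Data.Nat using (ℕ; zero; suc; _+_; _*_; _∸_; _≤_; _<_; z≤n; s≤s; NonZero; _%_; >-nonZero⁻¹)
open import Data.Nat.Properties
  using (+-commutativeSemigroup; n≤1+n; *-distribˡ-+; +-comm; +-identityʳ; *-comm; *-zeroʳ; *-identityʳ;
         m∸n+n≡m; ≤-refl; ≤-trans; <-≤-trans;
         m≤n⇒m≤1+n; m≤n⇒m<n∨m≡n; m<1+n⇒m≤n; ≤∧≢⇒<; ≤-antisym; <⇒≱; ≤-<-trans)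
  renaming (_≟_ to _≟ℕ_)
open import Data.Nat.DivMod using (%-distribˡ-+; %-distribˡ-*; m%n%n≡m%n; m%n<n)
open import Data.Nat.Divisibility
  using (_∣_; _∣?_; ∣-refl; ∣m∣n⇒∣m+n; ∣m+n∣m⇒∣n; ∣m⇒∣m*n; ∣n⇒∣m*n; ∣1⇒≡1; _∣0;
         n∣m⇒m%n≡0; m%n≡0⇒n∣m)
open import Data.Nat.Primality using (Prime; prime⇒nonZero; euclidsLemma; ¬prime[1])
open import Data.Nat.Tactic.RingSolver using (solve-∀)
open import Data.Fin using (Fin; zero; suc; toℕ; fromℕ<; _≟_)
open import Data.Fin.Properties using (any?; all?; toℕ-fromℕ<)
open import Data.Fin.Subset using (Subset; _∈_; _∉_; _⊆_; _⊂_; ∣_∣; ⊥; _∪_; ⁅_⁆; _-_; inside; outside)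
open import Data.Fin.Subset.Properties
  using (_∈?_; _⊆?_; _⊂?_; anySubset?; ⊆-min; ∉⊥; ∣⊥∣≡0; ∣p∣≤n; p⊆q⇒∣p∣≤∣q∣; p⊂q⇒∣p∣<∣q∣;
         ⊆-trans; x∈p∪q⁺; x∈p∪q⁻; x∈⁅x⁆; x∈⁅y⁆⇒x≡y; x∈p⇒p-x⊂p; x∈p∧x≢y⇒x∈p-y; p─q⊆p;
         ∪-identityʳ; p⊆p∪q)
open import Data.Vec using (Vec; []; _∷_; lookup; tabulate; there)
open import Data.Vec.Properties using ([]=⇒lookup; lookup⇒[]=; lookup∘tabulate)
open import Data.List using (List; []; _∷_; allFin)
open import Data.List.Membership.Propositional using () renaming (_∈_ to _∈ₗ_)
open import Data.List.Membership.Propositional.Properties using (∈-allFin)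
open import Data.List.Relation.Unary.Any using () renaming (here to hereₗ; there to thereₗ)
open import Data.Product using (∃; ∃-syntax; _×_; _,_; proj₁; proj₂)
open import Data.Sum using (_⊎_; inj₁; inj₂)
open import Function using (_∘_)
open import Relation.Nullary using (¬_; Dec; yes; no; does; contradiction)
open import Relation.Nullary.Decidable using (¬?; _×-dec_; _→-dec_; map′; dec-true; dec-false; decidable-stable)
open import Relation.Unary using (Decidable)
open import Relation.Binary.PropositionalEquality
open import Algebra.Properties.CommutativeSemigroup +-commutativeSemigroup using (interchange)

Vector : ℕ → Set
Vector n = Fin n → ℕ

infix 7 _⊙_

_⊙_ : ∀ {n} → Vector n → Vector n → ℕ
c ⊙ ρ = sumFin _ (λ u → c u * ρ u)

combine : ∀ {n} → ℕ → Vector n → ℕ → Vector n → Vector n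
combine x c y d u = x * c u + y * d u

unit : ∀ {n} → Fin n → Vector n
unit zero    zero    = 1
unit zero    (suc u) = 0
unit (suc a) zero    = 0
unit (suc a) (suc u) = unit a u

-- splitMatrix A a b α is of this shape: its lower rows are A and its top row is splitRow a b α.
lower : ∀ {m n} → Matrix (suc m) n → Matrix m n
lower B i = B (suc i)

sumFin-cong : ∀ n {f g : Vector n} → (∀ u → f u ≡ g u) → sumFin n f ≡ sumFin n g
sumFin-cong zero    f≗g = refl
sumFin-cong (suc n) f≗g = cong₂ _+_ (f≗g zero) (sumFin-cong n (f≗g ∘ suc))

sumFin-+ : ∀ n (f g : Vector n) → sumFin n (λ u → f u + g u) ≡ sumFin n f + sumFin n g
sumFin-+ zero    f g = refl
sumFin-+ (suc n) f g = begin
  f zero + g zero + sumFin n (λ u → f (suc u) + g (suc u))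
    ≡⟨ cong (f zero + g zero +_) (sumFin-+ n (f ∘ suc) (g ∘ suc)) ⟩
  f zero + g zero + (sumFin n (f ∘ suc) + sumFin n (g ∘ suc))
    ≡⟨ interchange (f zero) (g zero) _ _ ⟩
  f zero + sumFin n (f ∘ suc) + (g zero + sumFin n (g ∘ suc)) ∎
  where open ≡-Reasoning

sumFin-*ˡ : ∀ n x (f : Vector n) → sumFin n (λ u → x * f u) ≡ x * sumFin n f
sumFin-*ˡ zero    x f = sym (*-zeroʳ x)
sumFin-*ˡ (suc n) x f =
  trans (cong (x * f zero +_) (sumFin-*ˡ n x (f ∘ suc))) (sym (*-distribˡ-+ x (f zero) _))

⊙-comm : ∀ {n} (c d : Vector n) → c ⊙ d ≡ d ⊙ c
⊙-comm c d = sumFin-cong _ (λ u → *-comm (c u) (d u))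

combine-⊙ : ∀ {n} x (c : Vector n) y d ρ → combine x c y d ⊙ ρ ≡ x * (c ⊙ ρ) + y * (d ⊙ ρ)
combine-⊙ {n} x c y d ρ = begin
  sumFin n (λ u → (x * c u + y * d u) * ρ u)
    ≡⟨ sumFin-cong n (λ u → distribute x (c u) y (d u) (ρ u)) ⟩
  sumFin n (λ u → x * (c u * ρ u) + y * (d u * ρ u))
    ≡⟨ sumFin-+ n _ _ ⟩
  sumFin n (λ u → x * (c u * ρ u)) + sumFin n (λ u → y * (d u * ρ u))
    ≡⟨ cong₂ _+_ (sumFin-*ˡ n x _) (sumFin-*ˡ n y _) ⟩
  x * (c ⊙ ρ) + y * (d ⊙ ρ) ∎
  where
  open ≡-Reasoning
  distribute : ∀ x c y d r → (x * c + y * d) * r ≡ x * (c * r) + y * (d * r)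
  distribute = solve-∀

unit-⊙ : ∀ {n} (a : Fin n) (c : Vector n) → unit a ⊙ c ≡ c a
unit-⊙ {suc n} zero    c =
  trans (cong₂ _+_ (+-identityʳ (c zero)) (sumFin-*ˡ n 0 (c ∘ suc))) (+-identityʳ (c zero))
unit-⊙ {suc n} (suc a) c = unit-⊙ a (c ∘ suc)

unit-self : ∀ {n} (a : Fin n) → unit a a ≡ 1
unit-self zero    = refl
unit-self (suc a) = unit-self a

unit-≢ : ∀ {n} {a u : Fin n} → u ≢ a → unit a u ≡ 0
unit-≢ {a = zero}  {zero}  u≢a = contradiction refl u≢a
unit-≢ {a = zero}  {suc u} u≢a = refl
unit-≢ {a = suc a} {zero}  u≢a = refl
unit-≢ {a = suc a} {suc u} u≢a = unit-≢ (u≢a ∘ cong suc)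

splitRow-combine : ∀ {n} {a b : Fin n} → a ≢ b → ∀ α u →
  splitRow a b α u ≡ combine α (unit a) α (unit b) u
splitRow-combine {a = a} {b} a≢b α u with u ≟ a | u ≟ b
... | yes refl | _ rewrite unit-self u | unit-≢ a≢b | *-zeroʳ α | *-identityʳ α | +-identityʳ α = refl
... | no u≢a | yes refl rewrite unit-self u | unit-≢ u≢a | *-zeroʳ α | *-identityʳ α = refl
... | no u≢a | no u≢b rewrite unit-≢ u≢a | unit-≢ u≢b | *-zeroʳ α = refl

⊙-splitRow : ∀ {n} {a b : Fin n} → a ≢ b → ∀ α (c : Vector n) → c ⊙ splitRow a b α ≡ α * (c a + c b)
⊙-splitRow {n} {a} {b} a≢b α c = begin
  c ⊙ splitRow a b α
    ≡⟨ ⊙-comm c _ ⟩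
  splitRow a b α ⊙ c
    ≡⟨ sumFin-cong n (λ u → cong (_* c u) (splitRow-combine a≢b α u)) ⟩
  combine α (unit a) α (unit b) ⊙ c
    ≡⟨ combine-⊙ α (unit a) α (unit b) c ⟩
  α * (unit a ⊙ c) + α * (unit b ⊙ c)
    ≡⟨ cong₂ (λ x y → α * x + α * y) (unit-⊙ a c) (unit-⊙ b c) ⟩
  α * c a + α * c b
    ≡⟨ *-distribˡ-+ α (c a) (c b) ⟨
  α * (c a + c b) ∎
  where open ≡-Reasoning

x∉p-x : ∀ {n} (P : Subset n) x → x ∉ P - x
x∉p-x (s ∷ P) zero    ()
x∉p-x (s ∷ P) (suc x) (there x∈P-x) = x∉p-x P x x∈P-x

∣p∪⁅x⁆∣≤1+∣p∣ : ∀ {n} (P : Subset n) x → ∣ P ∪ ⁅ x ⁆ ∣ ≤ suc ∣ P ∣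
∣p∪⁅x⁆∣≤1+∣p∣ (inside  ∷ P) zero    rewrite ∪-identityʳ P = n≤1+n (suc ∣ P ∣)
∣p∪⁅x⁆∣≤1+∣p∣ (outside ∷ P) zero    rewrite ∪-identityʳ P = ≤-refl
∣p∪⁅x⁆∣≤1+∣p∣ (inside  ∷ P) (suc x) = s≤s (∣p∪⁅x⁆∣≤1+∣p∣ P x)
∣p∪⁅x⁆∣≤1+∣p∣ (outside ∷ P) (suc x) = ∣p∪⁅x⁆∣≤1+∣p∣ P x

∣p∣≤1+∣p-x∣ : ∀ {n} (P : Subset n) x → ∣ P ∣ ≤ suc ∣ P - x ∣
∣p∣≤1+∣p-x∣ P x = ≤-trans (p⊆q⇒∣p∣≤∣q∣ P⊆[P-x]∪x) (∣p∪⁅x⁆∣≤1+∣p∣ (P - x) x)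
  where
  P⊆[P-x]∪x : P ⊆ (P - x) ∪ ⁅ x ⁆
  P⊆[P-x]∪x {y} y∈P with y ≟ x
  ... | yes refl = x∈p∪q⁺ (inj₂ (x∈⁅x⁆ y))
  ... | no  y≢x  = x∈p∪q⁺ (inj₁ (x∈p∧x≢y⇒x∈p-y y∈P y≢x))

p∪⁅x⁆⊆q : ∀ {n} {P Q : Subset n} {x} → P ⊆ Q → x ∈ Q → P ∪ ⁅ x ⁆ ⊆ Q
p∪⁅x⁆⊆q {P = P} {x = x} P⊆Q x∈Q y∈ with x∈p∪q⁻ P ⁅ x ⁆ y∈
... | inj₁ y∈P = P⊆Q y∈P
... | inj₂ y∈x rewrite x∈⁅y⁆⇒x≡y x y∈x = x∈Q

widen : ∀ {n} {P : Subset n → Set} {X Y} → X ⊆ Y → ∃[ C ] (C ⊆ X × P C) → ∃[ C ] (C ⊆ Y × P C)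
widen X⊆Y (C , C⊆X , PC) = C , ⊆-trans C⊆X X⊆Y , PC

any-vector? : ∀ {X : Set} n → (∀ {Q : X → Set} → Decidable Q → Dec (∃ Q)) →
  {P : Vec X n → Set} → Decidable P → Dec (∃ P)
any-vector? zero    any-X? P? = map′ ([] ,_) (λ { ([] , P[]) → P[] }) (P? [])
any-vector? (suc n) any-X? P? =
  map′ (λ (x , xs , P[x∷xs]) → x ∷ xs , P[x∷xs])
       (λ { (x ∷ xs , P[x∷xs]) → x , xs , P[x∷xs] })
       (any-X? (λ x → any-vector? n any-X? (λ xs → P? (x ∷ xs))))

greatest : ∀ {Q : ℕ → Set} → Decidable Q → Q 0 → ∀ N → ∃[ k ] (Q k × (∀ j → j ≤ N → Q j → j ≤ k))
greatest Q? Q0 zero = 0 , Q0 , λ { j z≤n _ → z≤n }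
greatest {Q} Q? Q0 (suc N) with Q? (suc N) | greatest Q? Q0 N
... | yes QN | _ = suc N , QN , λ j j≤N _ → j≤N
... | no ¬QN | k , Qk , below = k , Qk , below-suc
  where
  below-suc : ∀ j → j ≤ suc N → Q j → j ≤ k
  below-suc j j≤1+N Qj with m≤n⇒m<n∨m≡n j≤1+N
  ... | inj₁ j<1+N = below j (m<1+n⇒m≤n j<1+N) Qj
  ... | inj₂ refl  = contradiction Qj ¬QN

module _ {p : ℕ} (p-prime : Prime p) where

  private instance
    p≢0 : NonZero p
    p≢0 = prime⇒nonZero p-prime

  negOne : ℕ
  negOne = p ∸ 1

  suc-negOne : suc negOne ≡ p
  suc-negOne = trans (+-comm 1 negOne) (m∸n+n≡m (>-nonZero⁻¹ p))

  negOne-cancels : ∀ x y → p ∣ x * y + negOne * y * x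
  negOne-cancels x y =
    subst (p ∣_) (sym (trans (regroup x y negOne) (cong (_* (x * y)) suc-negOne))) (∣m⇒∣m*n (x * y) ∣-refl)
    where
    regroup : ∀ x y q → x * y + q * y * x ≡ suc q * (x * y)
    regroup = solve-∀

  ∤negOne : ¬ p ∣ negOne
  ∤negOne p∣negOne = ¬prime[1] (subst Prime (∣1⇒≡1 p∣1) p-prime)
    where
    p∣1 : p ∣ 1
    p∣1 = ∣m+n∣m⇒∣n (subst (p ∣_) (sym (trans (+-comm negOne 1) suc-negOne)) ∣-refl) p∣negOne

  ∤m∧∤n⇒∤m*n : ∀ {x y} → ¬ p ∣ x → ¬ p ∣ y → ¬ p ∣ x * y
  ∤m∧∤n⇒∤m*n {x} {y} x∤ y∤ p∣xy with euclidsLemma x y p-prime p∣xy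
  ... | inj₁ p∣x = x∤ p∣x
  ... | inj₂ p∣y = y∤ p∣y

  ∣m∧∤n⇒∤m+n : ∀ {x y} → p ∣ x → ¬ p ∣ y → ¬ p ∣ x + y
  ∣m∧∤n⇒∤m+n p∣x y∤ p∣x+y = y∤ (∣m+n∣m⇒∣n p∣x+y p∣x)

  ∤m∧∣n⇒∤m+n : ∀ {x y} → ¬ p ∣ x → p ∣ y → ¬ p ∣ x + y
  ∤m∧∣n⇒∤m+n {x} {y} x∤ p∣y = ∣m∧∤n⇒∤m+n p∣y x∤ ∘ subst (p ∣_) (+-comm x y)

  ∣-resp-% : ∀ {x y} → x % p ≡ y % p → p ∣ x → p ∣ y
  ∣-resp-% {x} {y} x≡y p∣x = m%n≡0⇒n∣m y p (trans (sym x≡y) (n∣m⇒m%n≡0 x p p∣x))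

  +-resp-% : ∀ {x y x′ y′} → x % p ≡ y % p → x′ % p ≡ y′ % p → (x + x′) % p ≡ (y + y′) % p
  +-resp-% {x} {y} {x′} {y′} x≡y x′≡y′ = begin
    (x + x′) % p             ≡⟨ %-distribˡ-+ x x′ p ⟩
    (x % p + x′ % p) % p     ≡⟨ cong₂ (λ s t → (s + t) % p) x≡y x′≡y′ ⟩
    (y % p + y′ % p) % p     ≡⟨ %-distribˡ-+ y y′ p ⟨
    (y + y′) % p             ∎
    where open ≡-Reasoning

  *-resp-% : ∀ {x y} z → x % p ≡ y % p → (x * z) % p ≡ (y * z) % p
  *-resp-% {x} {y} z x≡y = begin
    (x * z) % p              ≡⟨ %-distribˡ-* x z p ⟩
    (x % p * (z % p)) % p    ≡⟨ cong (λ s → (s * (z % p)) % p) x≡y ⟩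
    (y % p * (z % p)) % p    ≡⟨ %-distribˡ-* y z p ⟨
    (y * z) % p              ∎
    where open ≡-Reasoning

  ⊙-resp-% : ∀ {n} {c d : Vector n} ρ → (∀ u → c u % p ≡ d u % p) → (c ⊙ ρ) % p ≡ (d ⊙ ρ) % p
  ⊙-resp-% {zero}  ρ c≡d = refl
  ⊙-resp-% {suc n} ρ c≡d = +-resp-% (*-resp-% (ρ zero) (c≡d zero)) (⊙-resp-% (ρ ∘ suc) (c≡d ∘ suc))

  ⊙-∣ : ∀ {n} {c : Vector n} ρ → (∀ u → p ∣ c u) → p ∣ c ⊙ ρ
  ⊙-∣ {zero}  ρ c∣ = p ∣0
  ⊙-∣ {suc n} ρ c∣ = ∣m∣n⇒∣m+n (∣m⇒∣m*n (ρ zero) (c∣ zero)) (⊙-∣ (ρ ∘ suc) (c∣ ∘ suc))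

  ∤⊙⇒∃∤ : ∀ {n} {c : Vector n} ρ → ¬ p ∣ c ⊙ ρ → ∃[ u ] ¬ p ∣ c u
  ∤⊙⇒∃∤ {c = c} ρ c∤ with any? (λ u → ¬? (p ∣? c u))
  ... | yes nonzero = nonzero
  ... | no  ¬nonzero = contradiction (⊙-∣ ρ (λ u → decidable-stable (p ∣? c u) (¬nonzero ∘ (u ,_)))) c∤

  ∉⇒∣ : ∀ {n} {c : Vector n} {T u} → SupportedOn p c T → u ∉ T → p ∣ c u
  ∉⇒∣ {c = c} {u = u} sup u∉T = decidable-stable (p ∣? c u) (u∉T ∘ sup u)

  combine-dependency : ∀ {m n} {A : Matrix m n} x {c} y {d} →
    IsDependency p A c → IsDependency p A d → IsDependency p A (combine x c y d)
  combine-dependency {A = A} x {c} y {d} c-dep d-dep i =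
    subst (p ∣_) (sym (combine-⊙ x c y d (A i)))
      (∣m∣n⇒∣m+n (∣n⇒∣m*n x (c-dep i)) (∣n⇒∣m*n y (d-dep i)))

  combine-∤ : ∀ {n} x {c : Vector n} y {d u} → ¬ p ∣ combine x c y d u → (¬ p ∣ c u) ⊎ (¬ p ∣ d u)
  combine-∤ x {c} y {d} {u} nonzero with p ∣? c u | p ∣? d u
  ... | no  cu∤ | _       = inj₁ cu∤
  ... | yes _   | no  du∤ = inj₂ du∤
  ... | yes cu∣ | yes du∣ = contradiction (∣m∣n⇒∣m+n (∣n⇒∣m*n x cu∣) (∣n⇒∣m*n y du∣)) nonzero

  combine-supported : ∀ {n} x {c : Vector n} y {d T} →
    SupportedOn p c T → SupportedOn p d T → SupportedOn p (combine x c y d) T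
  combine-supported x {c} y {d} c-sup d-sup u nonzero with combine-∤ x {c} y {d} nonzero
  ... | inj₁ cu∤ = c-sup u cu∤
  ... | inj₂ du∤ = d-sup u du∤

  independent⇒∣ : ∀ {m n} {A : Matrix m n} {T c} →
    Independent p A T → SupportedOn p c T → IsDependency p A c → ∀ u → p ∣ c u
  independent⇒∣ {c = c} ind sup dep u = decidable-stable (p ∣? c u) (λ cu∤ → ind (c , sup , dep , u , cu∤))

  -- φ y · x − φ x · y, on which the linear form φ vanishes
  cancel : ∀ {n} → (Vector n → ℕ) → Vector n → Vector n → Vector n
  cancel φ x y = combine (φ y) x (negOne * φ x) y

  cancel-dependency : ∀ {m n} {A : Matrix m n} φ {x y} →
    IsDependency p A x → IsDependency p A y → IsDependency p A (cancel φ x y)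
  cancel-dependency {A = A} φ {x} {y} = combine-dependency {A = A} (φ y) {x} (negOne * φ x) {y}

  cancel-supported : ∀ {n} φ {x y : Vector n} {T} →
    SupportedOn p x T → SupportedOn p y T → SupportedOn p (cancel φ x y) T
  cancel-supported φ {x} {y} = combine-supported (φ y) {x} (negOne * φ x) {y}

  cancel-∤ : ∀ {n} φ {x y : Vector n} {u} → ¬ p ∣ cancel φ x y u → (¬ p ∣ x u) ⊎ (¬ p ∣ y u)
  cancel-∤ φ {x} {y} = combine-∤ (φ y) {x} (negOne * φ x) {y}

  cancel-coordinate : ∀ {n} u (x y : Vector n) → p ∣ cancel (λ c → c u) x y u
  cancel-coordinate u x y = negOne-cancels (y u) (x u)

  cancel-⊙ : ∀ {n} (ρ x y : Vector n) → p ∣ cancel (_⊙ ρ) x y ⊙ ρ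
  cancel-⊙ ρ x y =
    subst (p ∣_) (sym (combine-⊙ (y ⊙ ρ) x (negOne * (x ⊙ ρ)) y ρ)) (negOne-cancels (y ⊙ ρ) (x ⊙ ρ))

  cancel-coordinate-∤⊙ : ∀ {n} {u} {ρ x y : Vector n} →
    ¬ p ∣ y u → ¬ p ∣ x ⊙ ρ → p ∣ y ⊙ ρ → ¬ p ∣ cancel (λ c → c u) x y ⊙ ρ
  cancel-coordinate-∤⊙ {u = u} {ρ} {x} {y} yu∤ xρ∤ yρ∣ =
    subst (¬_ ∘ (p ∣_)) (sym (combine-⊙ (y u) x (negOne * x u) y ρ))
      (∤m∧∣n⇒∤m+n (∤m∧∤n⇒∤m*n yu∤ xρ∤) (∣n⇒∣m*n (negOne * x u) yρ∣))

  supp : ∀ {n} → Vector n → Subset n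
  supp c = tabulate (λ u → not (does (p ∣? c u)))

  ∈supp⇒∤ : ∀ {n} {c : Vector n} {u} → u ∈ supp c → ¬ p ∣ c u
  ∈supp⇒∤ {c = c} {u} u∈supp cu∣ with trans (sym (lookup∘tabulate _ u)) ([]=⇒lookup u∈supp)
  ... | not[does]≡true rewrite dec-true (p ∣? c u) cu∣ = contradiction not[does]≡true λ ()

  ∤⇒∈supp : ∀ {n} {c : Vector n} {u} → ¬ p ∣ c u → u ∈ supp c
  ∤⇒∈supp {c = c} {u} cu∤ =
    lookup⇒[]= u (supp c) (trans (lookup∘tabulate _ u) (cong not (dec-false (p ∣? c u) cu∤)))

  supp⊆ : ∀ {n} {c : Vector n} {T} → SupportedOn p c T → supp c ⊆ T
  supp⊆ sup u∈supp = sup _ (∈supp⇒∤ u∈supp)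

  DependencyOn : ∀ {m n} → Matrix m n → Subset n → Vector n → Set
  DependencyOn A T c = SupportedOn p c T × IsDependency p A c × ∃[ u ] ¬ p ∣ c u

  dependencyOn? : ∀ {m n} (A : Matrix m n) T c → Dec (DependencyOn A T c)
  dependencyOn? A T c =
    all? (λ u → ¬? (p ∣? c u) →-dec (u ∈? T))
      ×-dec all? (λ i → p ∣? c ⊙ A i)
      ×-dec any? (λ u → ¬? (p ∣? c u))

  dependencyOn-resp-% : ∀ {m n} {A : Matrix m n} {T} {c d : Vector n} →
    (∀ u → c u % p ≡ d u % p) → DependencyOn A T c → DependencyOn A T d
  dependencyOn-resp-% c≡d (sup , dep , u , cu∤) =
    (λ v dv∤ → sup v (dv∤ ∘ ∣-resp-% (c≡d v))) ,
    (λ i → ∣-resp-% (⊙-resp-% _ c≡d) (dep i)) ,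
    (u , cu∤ ∘ ∣-resp-% (sym (c≡d u)))

  -- Coefficients only matter modulo p, so it suffices to search among vectors over Fin p.
  dependent? : ∀ {m n} (A : Matrix m n) T → Dec (Dependent p A T)
  dependent? {n = n} A T with any-vector? n any? (λ v → dependencyOn? A T (toℕ ∘ lookup v))
  ... | yes (_ , dependency) = yes (_ , dependency)
  ... | no  none = no λ (c , dependency) → none (residues c , dependencyOn-resp-% (residues-≡ c) dependency)
    where
    residues : Vector n → Vec (Fin p) n
    residues c = tabulate (λ u → fromℕ< (m%n<n (c u) p))
    residues-≡ : ∀ c u → c u % p ≡ toℕ (lookup (residues c) u) % p
    residues-≡ c u = sym (begin
      toℕ (lookup (residues c) u) % p        ≡⟨ cong (λ i → toℕ i % p) (lookup∘tabulate _ u) ⟩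
      toℕ (fromℕ< (m%n<n (c u) p)) % p       ≡⟨ cong (_% p) (toℕ-fromℕ< (m%n<n (c u) p)) ⟩
      c u % p % p                            ≡⟨ m%n%n≡m%n (c u) p ⟩
      c u % p                                ∎)
      where open ≡-Reasoning

  rank-exists : ∀ {m n} (A : Matrix m n) S → ∃[ k ] IsRank p A S k
  rank-exists {n = n} A S with greatest Q? (⊥ , ⊆-min S , ⊥-independent , ∣⊥∣≡0 n) n
    where
    Q? : Decidable (λ k → ∃[ T ] (T ⊆ S × Independent p A T × ∣ T ∣ ≡ k))
    Q? k = anySubset? (λ T → T ⊆? S ×-dec ¬? (dependent? A T) ×-dec ∣ T ∣ ≟ℕ k)
    ⊥-independent : Independent p A ⊥
    ⊥-independent (c , sup , _ , u , cu∤) = ∉⊥ (sup u cu∤)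
  ... | k , basis , largest = k , basis , λ T T⊆S ind → largest ∣ T ∣ (∣p∣≤n T) (T , T⊆S , ind , refl)

  Breaks : ∀ {m n} → Vector n → Matrix m n → Subset n → Set
  Breaks ρ A S = ∃[ c ] (SupportedOn p c S × IsDependency p A c × ¬ p ∣ c ⊙ ρ)

  module _ {m n} (B : Matrix (suc m) n) where

    raise-dependency : ∀ {c} → IsDependency p (lower B) c → p ∣ c ⊙ B zero → IsDependency p B c
    raise-dependency dep ρ∣ zero    = ρ∣
    raise-dependency dep ρ∣ (suc i) = dep i

    raise-independent : ∀ {T} → Independent p (lower B) T → Independent p B T
    raise-independent ind (c , sup , dep , nonzero) = ind (c , sup , (λ i → dep (suc i)) , nonzero)

    lower-independent : ∀ {S T} → ¬ Breaks (B zero) (lower B) S →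
      T ⊆ S → Independent p B T → Independent p (lower B) T
    lower-independent unbroken T⊆S ind (c , sup , dep , nonzero) with p ∣? c ⊙ B zero
    ... | yes ρ∣ = ind (c , sup , raise-dependency {c} dep ρ∣ , nonzero)
    ... | no  ρ∤ = unbroken (c , (λ u cu∤ → T⊆S (sup u cu∤)) , dep , ρ∤)

    isRank-unbroken : ∀ {S k} → ¬ Breaks (B zero) (lower B) S → IsRank p (lower B) S k → IsRank p B S k
    isRank-unbroken unbroken ((T , T⊆S , ind , ∣T∣≡k) , largest) =
      (T , T⊆S , raise-independent ind , ∣T∣≡k) ,
      λ T′ T′⊆S ind′ → largest T′ T′⊆S (lower-independent unbroken T′⊆S ind′)

    -- A dependency d on T - u either is already a B-dependency, or cancelling its top-row value
    -- against c gives a B-dependency on T that is nonzero at u.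
    remove-independent : ∀ {T c u} → Independent p B T →
      SupportedOn p c T → IsDependency p (lower B) c → ¬ p ∣ c u → Independent p (lower B) (T - u)
    remove-independent {T} {c} {u} ind c-sup c-dep cu∤ (d , d-sup , d-dep , v , dv∤)
      with p ∣? d ⊙ B zero
    ... | yes ρ∣ = ind (d , (λ w dw∤ → p─q⊆p T ⁅ u ⁆ (d-sup w dw∤)) , raise-dependency {d} d-dep ρ∣ , v , dv∤)
    ... | no  ρ∤ = eu∤ (independent⇒∣ ind e-sup e-dep u)
      where
      e : Vector n
      e = cancel (_⊙ B zero) d c
      e-dep : IsDependency p B e
      e-dep = raise-dependency {e}
        (cancel-dependency {A = lower B} (_⊙ B zero) {d} {c} d-dep c-dep) (cancel-⊙ (B zero) d c)
      e-sup : SupportedOn p e T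
      e-sup = cancel-supported (_⊙ B zero) (λ w dw∤ → p─q⊆p T ⁅ u ⁆ (d-sup w dw∤)) c-sup
      eu∤ : ¬ p ∣ e u
      eu∤ = ∣m∧∤n⇒∤m+n (∣n⇒∣m*n (c ⊙ B zero) (∉⇒∣ d-sup (x∉p-x T u)))
                       (∤m∧∤n⇒∤m*n (∤m∧∤n⇒∤m*n ∤negOne ρ∤) cu∤)

    size-≤-suc : ∀ {S k T} → (∀ T → T ⊆ S → Independent p (lower B) T → ∣ T ∣ ≤ k) →
      T ⊆ S → Independent p B T → ∣ T ∣ ≤ suc k
    size-≤-suc {T = T} bound T⊆S ind with dependent? (lower B) T
    ... | no  ind′ = m≤n⇒m≤1+n (bound T T⊆S ind′)
    ... | yes (c , sup , dep , u , cu∤) =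
      ≤-trans (∣p∣≤1+∣p-x∣ T u)
        (s≤s (bound (T - u) (T⊆S ∘ p─q⊆p T ⁅ u ⁆) (remove-independent ind sup dep cu∤)))

    Spans : Subset n → Subset n → Set
    Spans T₀ S = ∀ {u} → u ∈ S → u ∉ T₀ →
      ∃[ d ] (SupportedOn p d (T₀ ∪ ⁅ u ⁆) × IsDependency p B d × ¬ p ∣ d u)

    size-bound⇒spans : ∀ {S T₀} → T₀ ⊆ S → Independent p (lower B) T₀ →
      (∀ T → T ⊆ S → Independent p B T → ∣ T ∣ ≤ ∣ T₀ ∣) → Spans T₀ S
    size-bound⇒spans {S} {T₀} T₀⊆S ind₀ bound {u} u∈S u∉T₀ with dependent? B (T₀ ∪ ⁅ u ⁆)
    ... | no  ind = contradiction (bound _ (p∪⁅x⁆⊆q T₀⊆S u∈S) ind) (<⇒≱ (p⊂q⇒∣p∣<∣q∣ T₀⊂T₀+u))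
      where
      T₀⊂T₀+u : T₀ ⊂ T₀ ∪ ⁅ u ⁆
      T₀⊂T₀+u = p⊆p∪q ⁅ u ⁆ , u , x∈p∪q⁺ (inj₂ (x∈⁅x⁆ u)) , u∉T₀
    ... | yes (d , sup , dep , nonzero) = d , sup , dep , du∤
      where
      du∤ : ¬ p ∣ d u
      du∤ du∣ = ind₀ (d , sup₀ , (λ i → dep (suc i)) , nonzero)
        where
        sup₀ : SupportedOn p d T₀
        sup₀ v dv∤ with x∈p∪q⁻ T₀ ⁅ u ⁆ (sup v dv∤)
        ... | inj₁ v∈T₀ = v∈T₀
        ... | inj₂ v∈u  rewrite x∈⁅y⁆⇒x≡y u v∈u = contradiction du∣ dv∤

    -- Eliminate the coordinates of c outside T₀ one at a time with the dependencies given by Spans: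
    -- each step multiplies c ⊙ B zero by a unit, and the last vector lives on the independent T₀,
    -- hence vanishes.
    module _ {S T₀} (T₀⊆S : T₀ ⊆ S) (ind₀ : Independent p (lower B) T₀) (spans : Spans T₀ S) where

      drop-head : ∀ {c : Vector n} {u L} →
        (∀ v → ¬ p ∣ c v → v ∈ T₀ ⊎ v ∈ₗ u ∷ L) → (¬ p ∣ c u → u ∈ T₀) → ∀ v → ¬ p ∣ c v → v ∈ T₀ ⊎ v ∈ₗ L
      drop-head covered u-ok v cv∤ with covered v cv∤
      ... | inj₁ v∈T₀          = inj₁ v∈T₀
      ... | inj₂ (hereₗ refl)  = inj₁ (u-ok cv∤)
      ... | inj₂ (thereₗ v∈L)  = inj₂ v∈L

      spanned-∣⊙ : ∀ (L : List (Fin n)) {c : Vector n} → SupportedOn p c S → IsDependency p (lower B) c →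
        (∀ v → ¬ p ∣ c v → v ∈ T₀ ⊎ v ∈ₗ L) → p ∣ c ⊙ B zero
      spanned-∣⊙ [] sup dep covered = ⊙-∣ (B zero) (independent⇒∣ ind₀ sup₀ dep)
        where
        sup₀ : SupportedOn p _ T₀
        sup₀ v cv∤ with covered v cv∤
        ... | inj₁ v∈T₀ = v∈T₀
      spanned-∣⊙ (u ∷ L) {c} sup dep covered with p ∣? c u | u ∈? T₀
      ... | yes cu∣ | _        = spanned-∣⊙ L sup dep (drop-head {c} covered (λ cu∤ → contradiction cu∣ cu∤))
      ... | no  _   | yes u∈T₀ = spanned-∣⊙ L sup dep (drop-head {c} covered (λ _ → u∈T₀))
      ... | no  cu∤ | no  u∉T₀ with spans (sup u cu∤) u∉T₀
      ...   | d , d-sup , d-dep , du∤ =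
        decidable-stable (p ∣? c ⊙ B zero)
          (λ cρ∤ → cancel-coordinate-∤⊙ {u = u} {B zero} {c} {d} du∤ cρ∤ (d-dep zero)
                     (spanned-∣⊙ L c′-sup c′-dep c′-covered))
        where
        c′ : Vector n
        c′ = cancel (λ x → x u) c d
        c′-sup : SupportedOn p c′ S
        c′-sup = cancel-supported (λ x → x u) sup (λ v dv∤ → p∪⁅x⁆⊆q T₀⊆S (sup u cu∤) (d-sup v dv∤))
        c′-dep : IsDependency p (lower B) c′
        c′-dep = cancel-dependency {A = lower B} (λ x → x u) {c} {d} dep (λ i → d-dep (suc i))
        c′-covered : ∀ v → ¬ p ∣ c′ v → v ∈ T₀ ⊎ v ∈ₗ L
        c′-covered = drop-head {c′} covered-u (λ c′u∤ → contradiction (cancel-coordinate u c d) c′u∤)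
          where
          covered-u : ∀ v → ¬ p ∣ c′ v → v ∈ T₀ ⊎ v ∈ₗ u ∷ L
          covered-u v c′v∤ with cancel-∤ (λ x → x u) {c} {d} c′v∤
          ... | inj₁ cv∤ = covered v cv∤
          ... | inj₂ dv∤ with x∈p∪q⁻ T₀ ⁅ u ⁆ (d-sup v dv∤)
          ...   | inj₁ v∈T₀ = inj₁ v∈T₀
          ...   | inj₂ v∈u  = inj₂ (hereₗ (x∈⁅y⁆⇒x≡y u v∈u))

    spans⇒¬breaks : ∀ {S T₀} → T₀ ⊆ S → Independent p (lower B) T₀ → Spans T₀ S →
      ¬ Breaks (B zero) (lower B) S
    spans⇒¬breaks T₀⊆S ind₀ spans (c , sup , dep , cρ∤) =
      cρ∤ (spanned-∣⊙ T₀⊆S ind₀ spans (allFin n) sup dep (λ v _ → inj₂ (∈-allFin v)))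

    isRank-broken : ∀ {S k} → Breaks (B zero) (lower B) S → IsRank p (lower B) S k → IsRank p B S (suc k)
    isRank-broken {S} broken ((T₀ , T₀⊆S , ind₀ , refl) , largest) with rank-exists B S
    ... | k′ , rankB@((T₁ , T₁⊆S , ind₁ , refl) , largest′) =
      subst (IsRank p B S) (≤-antisym k′≤1+k (≤∧≢⇒< k≤k′ (k′≢k ∘ sym))) rankB
      where
      k≤k′ : ∣ T₀ ∣ ≤ k′
      k≤k′ = largest′ T₀ T₀⊆S (raise-independent ind₀)
      k′≤1+k : k′ ≤ suc ∣ T₀ ∣
      k′≤1+k = size-≤-suc largest T₁⊆S ind₁
      k′≢k : k′ ≢ ∣ T₀ ∣
      k′≢k k′≡k = spans⇒¬breaks T₀⊆S ind₀ (size-bound⇒spans T₀⊆S ind₀ bound) broken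
        where
        bound : ∀ T → T ⊆ S → Independent p B T → ∣ T ∣ ≤ ∣ T₀ ∣
        bound T T⊆S ind = subst (∣ T ∣ ≤_) k′≡k (largest′ T T⊆S ind)

  circuit-∤ : ∀ {m n} {A : Matrix m n} {C c x} → Circuit p A C →
    SupportedOn p c C → IsDependency p A c → ∃[ u ] ¬ p ∣ c u → x ∈ C → ¬ p ∣ c x
  circuit-∤ {C = C} {c} {x} (_ , minimal) sup dep nonzero x∈C cx∣ =
    minimal (C - x) (x∈p⇒p-x⊂p x∈C) (c , sup′ , dep , nonzero)
    where
    sup′ : SupportedOn p c (C - x)
    sup′ v cv∤ = x∈p∧x≢y⇒x∈p-y (sup v cv∤) (λ { refl → cv∤ cx∣ })

  exactly⇒supported : ∀ {n} {c : Vector n} {C} → SupportExactly p c C → SupportedOn p c C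
  exactly⇒supported {C = C} exact u cu∤ with u ∈? C
  ... | yes u∈C = u∈C
  ... | no  u∉C = contradiction (proj₂ (exact u) u∉C) cu∤

  BreaksCircuit : ∀ {m n} → Vector n → Matrix m n → Subset n → Set
  BreaksCircuit ρ A C = Circuit p A C × ∃[ e ] (SupportExactly p e C × IsDependency p A e × ¬ p ∣ e ⊙ ρ)

  module _ {m n} {A : Matrix m n} (ρ : Vector n) where

    support-breaksCircuit : ∀ {c} → IsDependency p A c → ¬ p ∣ c ⊙ ρ →
      (∀ T → T ⊂ supp c → Independent p A T) → BreaksCircuit ρ A (supp c)
    support-breaksCircuit {c} dep cρ∤ minimal =
      ((c , (λ _ → ∤⇒∈supp) , dep , ∤⊙⇒∃∤ ρ cρ∤) , minimal) ,
      c , (λ _ → ∈supp⇒∤ , ∉⇒∣ (λ _ → ∤⇒∈supp)) , dep , cρ∤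

    -- Induction on the size of the support: a dependency e on a proper subset is either broken
    -- itself, or cancelling it against c at one coordinate shrinks the support of c.
    breaksCircuit-within : ∀ N {c} → ∣ supp c ∣ < N → IsDependency p A c → ¬ p ∣ c ⊙ ρ →
      ∃[ C ] (C ⊆ supp c × BreaksCircuit ρ A C)
    breaksCircuit-within (suc N) {c} size dep cρ∤
      with anySubset? (λ T → T ⊂? supp c ×-dec dependent? A T)
    ... | no  none = supp c , (λ x∈ → x∈) , support-breaksCircuit dep cρ∤ (λ T T⊂ dT → none (T , T⊂ , dT))
    ... | yes (T , T⊂supp , e , e-sup , e-dep , u , eu∤) with p ∣? e ⊙ ρ
    ...   | no  eρ∤ = widen (⊆-trans (supp⊆ e-sup) (proj₁ T⊂supp))
                        (breaksCircuit-within N size-e e-dep eρ∤)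
      where
      size-e : ∣ supp e ∣ < N
      size-e = ≤-<-trans (p⊆q⇒∣p∣≤∣q∣ (supp⊆ e-sup)) (<-≤-trans (p⊂q⇒∣p∣<∣q∣ T⊂supp) (m<1+n⇒m≤n size))
    ...   | yes eρ∣ = widen (proj₁ c′⊂c) (breaksCircuit-within N size-c′ c′-dep c′ρ∤)
      where
      c′ : Vector n
      c′ = cancel (λ x → x u) c e
      c′-dep : IsDependency p A c′
      c′-dep = cancel-dependency {A = A} (λ x → x u) {c} {e} dep e-dep
      c′ρ∤ : ¬ p ∣ c′ ⊙ ρ
      c′ρ∤ = cancel-coordinate-∤⊙ {u = u} {ρ} {c} {e} eu∤ cρ∤ eρ∣
      c′⊂c : supp c′ ⊂ supp c
      c′⊂c = supp⊆ (cancel-supported (λ x → x u) (λ _ → ∤⇒∈supp) (λ v ev∤ → proj₁ T⊂supp (e-sup v ev∤))) ,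
             u , proj₁ T⊂supp (e-sup u eu∤) , (λ u∈ → ∈supp⇒∤ u∈ (cancel-coordinate u c e))
      size-c′ : ∣ supp c′ ∣ < N
      size-c′ = <-≤-trans (p⊂q⇒∣p∣<∣q∣ c′⊂c) (m<1+n⇒m≤n size)

    breaks⇒breaksCircuit : ∀ {S} → Breaks ρ A S → ∃[ C ] (C ⊆ S × BreaksCircuit ρ A C)
    breaks⇒breaksCircuit (c , sup , dep , cρ∤) =
      widen (supp⊆ sup) (breaksCircuit-within (suc ∣ supp c ∣) ≤-refl dep cρ∤)

  module _ {m n} {A : Matrix m n} {a b : Fin n} (a≢b : a ≢ b) {α} (α∤ : ¬ p ∣ α) where

    ∤sum⇒∤⊙splitRow : ∀ {c} → ¬ p ∣ c a + c b → ¬ p ∣ c ⊙ splitRow a b α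
    ∤sum⇒∤⊙splitRow {c} sum∤ = subst (¬_ ∘ (p ∣_)) (sym (⊙-splitRow a≢b α c)) (∤m∧∤n⇒∤m*n α∤ sum∤)

    ∤⊙splitRow⇒∤sum : ∀ {c} → ¬ p ∣ c ⊙ splitRow a b α → ¬ p ∣ c a + c b
    ∤⊙splitRow⇒∤sum {c} ρ∤ sum∣ = ρ∤ (subst (p ∣_) (sym (⊙-splitRow a≢b α c)) (∣n⇒∣m*n α sum∣))

    npCircuit-vector : ∀ {C} → NpCircuit p A a b C →
      ∃[ c ] (SupportedOn p c C × IsDependency p A c × ¬ p ∣ c a + c b)
    npCircuit-vector (circuit@((c , sup , dep , nonzero) , _) , inj₁ (a∈C , b∉C)) =
      c , sup , dep , ∤m∧∣n⇒∤m+n (circuit-∤ circuit sup dep nonzero a∈C) (∉⇒∣ sup b∉C)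
    npCircuit-vector (circuit@((c , sup , dep , nonzero) , _) , inj₂ (inj₁ (a∉C , b∈C))) =
      c , sup , dep , ∣m∧∤n⇒∤m+n (∉⇒∣ sup a∉C) (circuit-∤ circuit sup dep nonzero b∈C)
    npCircuit-vector (_ , inj₂ (inj₂ (_ , _ , c , exact , dep , sum∤))) =
      c , exactly⇒supported exact , dep , sum∤

    npCircuit⇒breaks : ∀ {C S} → C ⊆ S → NpCircuit p A a b C → Breaks (splitRow a b α) A S
    npCircuit⇒breaks C⊆S np with npCircuit-vector np
    ... | c , sup , dep , sum∤ = c , (λ u cu∤ → C⊆S (sup u cu∤)) , dep , ∤sum⇒∤⊙splitRow {c} sum∤

    breaksCircuit⇒npCircuit : ∀ {C} → BreaksCircuit (splitRow a b α) A C → NpCircuit p A a b C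
    breaksCircuit⇒npCircuit {C} (circuit , e , exact , dep , eρ∤) with a ∈? C | b ∈? C
    ... | yes a∈C | yes b∈C = circuit , inj₂ (inj₂ (a∈C , b∈C , e , exact , dep , ∤⊙splitRow⇒∤sum {e} eρ∤))
    ... | yes a∈C | no  b∉C = circuit , inj₁ (a∈C , b∉C)
    ... | no  a∉C | yes b∈C = circuit , inj₂ (inj₁ (a∉C , b∈C))
    ... | no  a∉C | no  b∉C =
      contradiction (∣m∣n⇒∣m+n (proj₂ (exact a) a∉C) (proj₂ (exact b) b∉C)) (∤⊙splitRow⇒∤sum {e} eρ∤)

    breaks⇒npCircuit : ∀ {S} → Breaks (splitRow a b α) A S → ∃[ C ] (C ⊆ S × NpCircuit p A a b C)
    breaks⇒npCircuit broken with breaks⇒breaksCircuit (splitRow a b α) broken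
    ... | C , C⊆S , breaksCircuit = C , C⊆S , breaksCircuit⇒npCircuit breaksCircuit

mainTheorem5 : ∀ (p : ℕ) → Prime p → ∀ {m n} (A : Matrix m n) (a b : Fin n) → a ≢ b →
    (α : ℕ) → ¬ (p ∣ α) → (S : Subset n) →
      ((¬ (∃[ C ] (C ⊆ S × NpCircuit p A a b C))) →
         ∃[ k ] (IsRank p A S k × IsRank p (splitMatrix A a b α) S k))
      × ((∃[ C ] (C ⊆ S × NpCircuit p A a b C)) →
         ∃[ k ] (IsRank p A S k × IsRank p (splitMatrix A a b α) S (suc k)))
mainTheorem5 p p-prime A a b a≢b α α∤ S with rank-exists p-prime A S
... | k , rankA =
  (λ no-npCircuit → k , rankA ,
     isRank-unbroken p-prime (splitMatrix A a b α) (no-npCircuit ∘ breaks⇒npCircuit p-prime a≢b α∤) rankA) ,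
  (λ (C , C⊆S , npCircuit) → k , rankA ,
     isRank-broken p-prime (splitMatrix A a b α) (npCircuit⇒breaks p-prime a≢b α∤ C⊆S npCircuit) rankA)
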